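{- Let $h,k,q\in\mathbb{Z}_{>0}$ be pairwise coprime. Let $[0;b_1,\dots,b_r]$ and $[0;c_1,\dots,c_s]$ be continued fraction expansions of $\{ -h\overline q/k\}$ and $\{ -k\overline q/h\}$ respectively, with $r$ and $s$ even, where in each case $\overline q$ denotes the inverse of $q$ modulo the denominator ($k$, resp. $h$). If $q\ge4hk$, then the continued fraction expansion of $\{h\overline k/q\}$ (with $\overline k$ the inverse of $k$ mod $q$) is $[0;b_1,\dots,b_r,d,c_s,\dots,c_1]$ for some positive integer $d=\frac q{hk}+O(1)$ (absolute implied constant).
   Context: $\{x\}$ denotes the fractional part of $x$. -}

module Defs where

open import Data.Nat using (ℕ; _+_; _*_)
open import Data.List using (List; []; _∷_)
open import Data.Product using (_×_; _,_; proj₁; proj₂)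
open import Relation.Binary.PropositionalEquality using (_≡_)

-- Finite continued fraction [0; a₁, …, aₙ] computed as a pair
-- (numerator , denominator) via  [0; a, rest] = 1 / (a + [0; rest]).
-- [0;] = 0/1 ;  [0; a, rest] = q / (a*q + p)  where p/q = [0; rest].
cf : List ℕ → ℕ × ℕ
cf [] = 0 , 1
cf (a ∷ as) = proj₂ (cf as) , a * proj₂ (cf as) + proj₁ (cf as)

IsCF : ℕ → ℕ → List ℕ → Set
IsCF N K as = proj₁ (cf as) * K ≡ proj₂ (cf as) * N

{-# OPTIONS --safe #-}
-- Let α/γ and N/k be the last two convergents of [0; bs]. For an expansion of even length the
-- convergent matrix has determinant α k − N γ = 1; together with N ≡ −h q̄ (mod k) this gives
-- h γ ≡ q (mod k), and γ ≤ k. Symmetrically k γ′ ≡ q (mod h) and γ′ ≤ h for cs. Reversing a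
-- continued fraction transposes its matrix, so [0; bs, d, reverse cs] has denominator
-- X + d h k, where X = h γ + k γ′, and a numerator P with P k = h + N q, i.e. P ≡ h k̄ (mod q).
-- As X ≡ q modulo h and modulo k, and X ≤ 2hk < q, some d ≥ 1 gives q = X + d h k; then
-- |d h k − q| = X ≤ 2hk.
module Submission where

open import Defs

module ContinuedFraction where

  open import Data.Nat using (ℕ; suc; _+_; _*_; _≤_; _<_; z≤n; NonZero)
  open import Data.Nat.Properties
  open import Data.Nat.Tactic.RingSolver using (solve-∀)
  open import Data.Nat.Coprimality using (Coprime; coprime-divisor)
  import Data.Nat.Coprimality as Coprime
  open import Data.Nat.Divisibility
    using (_∣_; divides; ∣-refl; ∣-antisym; ∣1⇒≡1; ∣m+n∣m⇒∣n; ∣n⇒∣m*n; n∣m*n)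
  open import Data.List using (List; []; _∷_; _++_; length; reverse; [_])
  open import Data.List.Properties using (unfold-reverse)
  open import Data.List.Relation.Unary.All using (All; []; _∷_)
  open import Data.Product using (_×_; _,_; proj₁; proj₂)
  open import Relation.Nullary using (contradiction)
  open import Relation.Binary.PropositionalEquality hiding ([_])

  -- cfWith as (x , y) is [0; a₁, …, aₙ + x/y]; in particular cf as = cfWith as (0 , 1).
  cfWith : List ℕ → ℕ × ℕ → ℕ × ℕ
  cfWith []       v = v
  cfWith (a ∷ as) v = proj₂ (cfWith as v) , a * proj₂ (cfWith as v) + proj₁ (cfWith as v)

  -- The penultimate convergent [0; a₁, …, aₙ₋₁] (and 1/0 for the empty expansion).
  cf⁻ : List ℕ → ℕ × ℕ
  cf⁻ as = cfWith as (1 , 0)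

  num den num⁻ den⁻ : List ℕ → ℕ
  num  as = proj₁ (cf as)
  den  as = proj₂ (cf as)
  num⁻ as = proj₁ (cf⁻ as)
  den⁻ as = proj₂ (cf⁻ as)

  cf≡cfWith : ∀ as → cf as ≡ cfWith as (0 , 1)
  cf≡cfWith []       = refl
  cf≡cfWith (a ∷ as) rewrite cf≡cfWith as = refl

  cfWith-++ : ∀ xs ys v → cfWith (xs ++ ys) v ≡ cfWith xs (cfWith ys v)
  cfWith-++ []       ys v = refl
  cfWith-++ (x ∷ xs) ys v rewrite cfWith-++ xs ys v = refl

  cf-++ : ∀ xs ys → cf (xs ++ ys) ≡ cfWith xs (cf ys)
  cf-++ xs ys = begin
    cf (xs ++ ys)                  ≡⟨ cf≡cfWith (xs ++ ys) ⟩
    cfWith (xs ++ ys) (0 , 1)      ≡⟨ cfWith-++ xs ys (0 , 1) ⟩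
    cfWith xs (cfWith ys (0 , 1))  ≡⟨ cong (cfWith xs) (cf≡cfWith ys) ⟨
    cfWith xs (cf ys)              ∎
    where open ≡-Reasoning

  cfWith-linear : ∀ as x y →
    cfWith as (x , y) ≡ (x * num⁻ as + y * num as , x * den⁻ as + y * den as)
  cfWith-linear []       x y = cong₂ _,_ (first x y) (second x y)
    where
    first : ∀ x y → x ≡ x * 1 + y * 0
    first = solve-∀
    second : ∀ x y → y ≡ x * 0 + y * 1
    second = solve-∀
  cfWith-linear (a ∷ as) x y rewrite cfWith-linear as x y =
    cong₂ _,_ refl (expand a x y (num⁻ as) (den⁻ as) (num as) (den as))
    where
    expand : ∀ a x y p⁻ q⁻ p q →
      a * (x * q⁻ + y * q) + (x * p⁻ + y * p) ≡ x * (a * q⁻ + p⁻) + y * (a * q + p)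
    expand = solve-∀

  -- Reversal transposes the matrix whose columns are cf⁻ as and cf as.
  cf-reverse : ∀ as → cf⁻ (reverse as) ≡ (num⁻ as , num as) × cf (reverse as) ≡ (den⁻ as , den as)
  cf-reverse []       = refl , refl
  cf-reverse (a ∷ as) = column₁ , column₂
    where
    R = reverse as
    open ≡-Reasoning
    column₁ : cf⁻ (reverse (a ∷ as)) ≡ (den⁻ as , den as)
    column₁ = begin
      cf⁻ (reverse (a ∷ as))      ≡⟨ cong cf⁻ (unfold-reverse a as) ⟩
      cfWith (R ++ [ a ]) (1 , 0) ≡⟨ cfWith-++ R [ a ] (1 , 0) ⟩
      cfWith R (0 , a * 0 + 1)    ≡⟨ cfWith-linear R 0 (a * 0 + 1) ⟩
      (0 * num⁻ R + (a * 0 + 1) * num R , 0 * den⁻ R + (a * 0 + 1) * den R)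
        ≡⟨ cong₂ _,_ (cancel a (num⁻ R) (num R)) (cancel a (den⁻ R) (den R)) ⟩
      cf R                        ≡⟨ proj₂ (cf-reverse as) ⟩
      (den⁻ as , den as)          ∎
      where
      cancel : ∀ a u v → 0 * u + (a * 0 + 1) * v ≡ v
      cancel = solve-∀
    column₂ : cf (reverse (a ∷ as)) ≡ (den⁻ (a ∷ as) , den (a ∷ as))
    column₂ = begin
      cf (reverse (a ∷ as))       ≡⟨ cong cf (unfold-reverse a as) ⟩
      cf (R ++ [ a ])             ≡⟨ cf-++ R [ a ] ⟩
      cfWith R (1 , a * 1 + 0)    ≡⟨ cfWith-linear R 1 (a * 1 + 0) ⟩
      (1 * num⁻ R + (a * 1 + 0) * num R , 1 * den⁻ R + (a * 1 + 0) * den R)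
        ≡⟨ cong₂ (λ u v → (1 * proj₁ u + (a * 1 + 0) * proj₁ v , 1 * proj₂ u + (a * 1 + 0) * proj₂ v))
                 (proj₁ (cf-reverse as)) (proj₂ (cf-reverse as)) ⟩
      (1 * num⁻ as + (a * 1 + 0) * den⁻ as , 1 * num as + (a * 1 + 0) * den as)
        ≡⟨ cong₂ _,_ (collect a (num⁻ as) (den⁻ as)) (collect a (num as) (den as)) ⟩
      (a * den⁻ as + num⁻ as , a * den as + num as) ∎
      where
      collect : ∀ a u v → 1 * u + (a * 1 + 0) * v ≡ a * v + u
      collect = solve-∀

  det-even : ∀ as → 2 ∣ length as → num⁻ as * den as ≡ 1 + den⁻ as * num as
  det-odd  : ∀ as → 2 ∣ suc (length as) → den⁻ as * num as ≡ 1 + num⁻ as * den as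
  det-even []       _    = refl
  det-even (a ∷ as) even = begin
    den⁻ as * (a * den as + num as)              ≡⟨ expand a (den⁻ as) (den as) (num as) ⟩
    a * den⁻ as * den as + den⁻ as * num as      ≡⟨ cong (a * den⁻ as * den as +_) (det-odd as even) ⟩
    a * den⁻ as * den as + (1 + num⁻ as * den as) ≡⟨ collect a (den⁻ as) (den as) (num⁻ as) ⟩
    1 + (a * den⁻ as + num⁻ as) * den as         ∎
    where
    open ≡-Reasoning
    expand : ∀ a u v w → u * (a * v + w) ≡ a * u * v + u * w
    expand = solve-∀
    collect : ∀ a u v w → a * u * v + (1 + w * v) ≡ 1 + (a * u + w) * v
    collect = solve-∀
  det-odd []       2∣1  = contradiction (∣1⇒≡1 2∣1) λ ()
  det-odd (a ∷ as) odd  = begin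
    (a * den⁻ as + num⁻ as) * den as             ≡⟨ expand a (den⁻ as) (den as) (num⁻ as) ⟩
    a * den⁻ as * den as + num⁻ as * den as
      ≡⟨ cong (a * den⁻ as * den as +_) (det-even as (∣m+n∣m⇒∣n odd ∣-refl)) ⟩
    a * den⁻ as * den as + (1 + den⁻ as * num as) ≡⟨ collect a (den⁻ as) (den as) (num as) ⟩
    1 + den⁻ as * (a * den as + num as)          ∎
    where
    open ≡-Reasoning
    expand : ∀ a u v w → (a * u + w) * v ≡ a * u * v + w * v
    expand = solve-∀
    collect : ∀ a u v w → a * u * v + (1 + u * w) ≡ 1 + u * (a * v + w)
    collect = solve-∀

  den⁻≤den : ∀ {as} → All (0 <_) as → den⁻ as ≤ den as
  den⁻≤den []                   = z≤n
  den⁻≤den {a ∷ []} (a>0 ∷ [])   = begin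
    a * 0 + 1 ≡⟨ cong (_+ 1) (*-zeroʳ a) ⟩
    1         ≤⟨ a>0 ⟩
    a         ≡⟨ sym (trans (+-identityʳ (a * 1)) (*-identityʳ a)) ⟩
    a * 1 + 0 ∎
    where open ≤-Reasoning
  den⁻≤den {a ∷ _ ∷ _} (_ ∷ positive@(_ ∷ positive′)) =
    +-mono-≤ (*-monoʳ-≤ a (den⁻≤den positive)) (den⁻≤den positive′)

  unimodular⇒coprime : ∀ {x y m n} → x * n ≡ 1 + y * m → Coprime m n
  unimodular⇒coprime {x} {y} {m} {n} eq {i} (i∣m , i∣n) =
    ∣1⇒≡1 (∣m+n∣m⇒∣n (subst (i ∣_) (trans eq (+-comm 1 (y * m))) (∣n⇒∣m*n x i∣n)) (∣n⇒∣m*n y i∣m))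

  reduced-unique : ∀ {a b c d} .{{_ : NonZero d}} → Coprime a b → Coprime c d →
                   a * d ≡ b * c → a ≡ c × b ≡ d
  reduced-unique {a} {b} {c} {d} a⊥b c⊥d ad≡bc = a≡c , b≡d
    where
    b∣d : b ∣ d
    b∣d = coprime-divisor (Coprime.sym a⊥b) (divides c (trans ad≡bc (*-comm b c)))
    d∣b : d ∣ b
    d∣b = coprime-divisor (Coprime.sym c⊥d) (subst (d ∣_) (trans ad≡bc (*-comm b c)) (n∣m*n a))
    b≡d = ∣-antisym b∣d d∣b
    a≡c : a ≡ c
    a≡c = *-cancelʳ-≡ a c d (trans ad≡bc (trans (cong (_* c) b≡d) (*-comm d c)))

  reduced-expansion : ∀ {N K as} .{{_ : NonZero K}} → Coprime N K → 2 ∣ length as →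
                      IsCF N K as → num as ≡ N × den as ≡ K
  reduced-expansion {as = as} N⊥K even =
    reduced-unique (unimodular⇒coprime {num⁻ as} {den⁻ as} (det-even as even)) N⊥K


module Congruence where

  open import Data.Nat as ℕ using (NonZero)
  open import Data.Nat.Coprimality using (Coprime)
  open import Data.Integer using (+_; -_; _+_; _-_; _*_; 1ℤ; ∣_∣; _%ℕ_; _/ℕ_)
  open import Data.Integer.Properties using (pos-+; pos-*; ∣-i∣≡∣i∣)
  open import Data.Integer.DivMod using (a≡a%ℕn+[a/ℕn]*n)
  open import Data.Integer.Divisibility.Signed
    using (_∣_; divides; ∣-refl; ∣-trans; ∣m∣n⇒∣m+n; ∣m∣n⇒∣m-n; ∣n⇒∣m*n; ∣ᵤ⇒∣; ∣⇒∣ᵤ)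
  open import Data.Integer.Tactic.RingSolver using (solve-∀)
  open import Data.Product using (_,_)
  open import Relation.Binary.PropositionalEquality

  %ℕ-congruent : ∀ a k .{{_ : NonZero k}} → + k ∣ + (a %ℕ k) - a
  %ℕ-congruent a k = divides (- (a /ℕ k)) (begin
    + (a %ℕ k) - a                              ≡⟨ cong (λ x → + (a %ℕ k) - x) (a≡a%ℕn+[a/ℕn]*n a k) ⟩
    + (a %ℕ k) - (+ (a %ℕ k) + a /ℕ k * + k)    ≡⟨ cancel (+ (a %ℕ k)) (a /ℕ k) (+ k) ⟩
    - (a /ℕ k) * + k                            ∎)
    where
    open ≡-Reasoning
    cancel : ∀ r x k → r - (r + x * k) ≡ - x * k
    cancel = solve-∀

  %-congruent : ∀ {m n} k .{{_ : NonZero k}} → m ℕ.% k ≡ n ℕ.% k → + k ∣ + m - + n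
  %-congruent {m} {n} k m≡n = subst (+ k ∣_) (swap (+ (n ℕ.% k)) (+ m) (+ n))
    (∣m∣n⇒∣m-n (%ℕ-congruent (+ n) k) (subst (λ r → + k ∣ + r - + m) m≡n (%ℕ-congruent (+ m) k)))
    where
    swap : ∀ r m n → (r - n) - (r - m) ≡ m - n
    swap = solve-∀

  neg-inverse-congruence : ∀ {h q q̄} k .{{_ : NonZero k}} → + k ∣ + q * + q̄ - 1ℤ →
    + k ∣ + q * + ((- + (h ℕ.* q̄)) %ℕ k) + + h
  neg-inverse-congruence {h} {q} {q̄} k k∣qq̄-1 = subst (+ k ∣_) (identity (+ q) (+ N) (+ h) (+ q̄))
    (∣m∣n⇒∣m-n (∣n⇒∣m*n (+ q) k∣N+hq̄) (∣n⇒∣m*n (+ h) k∣qq̄-1))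
    where
    N = (- + (h ℕ.* q̄)) %ℕ k
    k∣N+hq̄ : + k ∣ + N - - (+ h * + q̄)
    k∣N+hq̄ = subst (λ x → + k ∣ + N - - x) (pos-* h q̄) (%ℕ-congruent (- + (h ℕ.* q̄)) k)
    identity : ∀ q N h q̄ → q * (N - - (h * q̄)) - h * (q * q̄ - 1ℤ) ≡ q * N + h
    identity = solve-∀

  congruence⇒coprime : ∀ {h q N k} → Coprime h k → + k ∣ + q * + N + + h → Coprime N k
  congruence⇒coprime {h} {q} {N} h⊥k k∣qN+h {i} (i∣N , i∣k) = h⊥k (∣⇒∣ᵤ i∣h , i∣k)
    where
    cancel : ∀ q N h → (q * N + h) - q * N ≡ h
    cancel = solve-∀
    i∣h : + i ∣ + h
    i∣h = subst (+ i ∣_) (cancel (+ q) (+ N) (+ h))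
      (∣m∣n⇒∣m-n (∣-trans (∣ᵤ⇒∣ i∣k) k∣qN+h) (∣n⇒∣m*n (+ q) (∣ᵤ⇒∣ i∣N)))

  inverse-congruence : ∀ {h q N k α γ} → + k ∣ + q * + N + + h → α ℕ.* k ≡ 1 ℕ.+ N ℕ.* γ →
    + k ∣ + (h ℕ.* γ) - + q
  inverse-congruence {h} {q} {N} {k} {α} {γ} k∣qN+h αk≡1+Nγ =
    subst (+ k ∣_) (trans (identity (+ q) (+ N) (+ h) (+ γ)) (cong (λ x → x - + q) (sym (pos-* h γ))))
      (∣m∣n⇒∣m-n (∣n⇒∣m*n (+ γ) k∣qN+h) (∣n⇒∣m*n (+ q) k∣1+Nγ))
    where
    k∣1+Nγ : + k ∣ 1ℤ + + N * + γ
    k∣1+Nγ = divides (+ α) (begin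
      1ℤ + + N * + γ   ≡⟨ cong (λ x → 1ℤ + x) (pos-* N γ) ⟨
      1ℤ + + (N ℕ.* γ) ≡⟨ pos-+ 1 (N ℕ.* γ) ⟨
      + (1 ℕ.+ N ℕ.* γ) ≡⟨ cong +_ αk≡1+Nγ ⟨
      + (α ℕ.* k)      ≡⟨ pos-* α k ⟩
      + α * + k        ∎)
      where open ≡-Reasoning
    identity : ∀ q N h γ → γ * (q * N + h) - q * (1ℤ + N * γ) ≡ h * γ - q
    identity = solve-∀

  ∣+n-+[m+n]∣≡m : ∀ m n → ∣ + n - + (m ℕ.+ n) ∣ ≡ m
  ∣+n-+[m+n]∣≡m m n =
    trans (cong ∣_∣ (trans (cong (λ x → + n - x) (pos-+ m n)) (cancel (+ m) (+ n)))) (∣-i∣≡∣i∣ (+ m))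
    where
    cancel : ∀ m n → n - (m + n) ≡ - m
    cancel = solve-∀

  ∣[a+k*b]-c : ∀ {a c} k b → + k ∣ + a - + c → + k ∣ + (a ℕ.+ k ℕ.* b) - + c
  ∣[a+k*b]-c {a} {c} k b k∣a-c = subst (+ k ∣_) regroup (∣m∣n⇒∣m+n k∣a-c (∣n⇒∣m*n (+ b) ∣-refl))
    where
    shift : ∀ a b c k → (a - c) + b * k ≡ (a + k * b) - c
    shift = solve-∀
    regroup : (+ a - + c) + + b * + k ≡ + (a ℕ.+ k ℕ.* b) - + c
    regroup = begin
      (+ a - + c) + + b * + k    ≡⟨ shift (+ a) (+ b) (+ c) (+ k) ⟩
      (+ a + + k * + b) - + c    ≡⟨ cong (λ y → (+ a + y) - + c) (pos-* k b) ⟨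
      (+ a + + (k ℕ.* b)) - + c  ≡⟨ cong (λ x → x - + c) (pos-+ a (k ℕ.* b)) ⟨
      + (a ℕ.+ k ℕ.* b) - + c    ∎
      where open ≡-Reasoning

open ContinuedFraction
open Congruence
open import Data.Nat using (ℕ; _+_; _*_; _∸_; _%_; _≤_; _<_; NonZero; >-nonZero⁻¹)
open import Data.Nat.Properties
open import Data.Nat.Tactic.RingSolver using (solve-∀)
open import Data.Nat.Coprimality using (Coprime; coprime-divisor)
import Data.Nat.Coprimality as Coprime
open import Data.Nat.Divisibility using (_∣_; divides; quotient)
open import Data.Nat.DivMod using ([m+kn]%n≡m%n; %-distribˡ-*; m<n⇒m%n≡m)
open import Data.Integer using (+_; -_; _-_; ∣_∣; _%ℕ_; 1ℤ)
import Data.Integer as ℤ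
open import Data.Integer.Properties using (pos-*; [+m]-[+n]≡m⊖n; ∣⊖∣-≤)
open import Data.Integer.DivMod using (n%ℕd<d)
open import Data.Integer.Divisibility.Signed using (∣⇒∣ᵤ) renaming (_∣_ to _∣ᵢ_)
open import Data.List using (List; _∷_; _++_; length; reverse)
open import Data.List.Relation.Unary.All using (All)
open import Data.Product using (∃-syntax; _×_; _,_; proj₁; proj₂)
open import Relation.Binary.PropositionalEquality

coprime⇒*∣ : ∀ {m n o} → Coprime m n → m ∣ o → n ∣ o → m * n ∣ o
coprime⇒*∣ {m} {n} {o} m⊥n (divides a o≡a*m) n∣o = divides (quotient n∣a) (begin
  o                       ≡⟨ o≡a*m ⟩
  a * m                   ≡⟨ cong (_* m) (_∣_.equality n∣a) ⟩
  quotient n∣a * n * m    ≡⟨ *-assoc (quotient n∣a) n m ⟩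
  quotient n∣a * (n * m)  ≡⟨ cong (quotient n∣a *_) (*-comm n m) ⟩
  quotient n∣a * (m * n)  ∎)
  where
  open ≡-Reasoning
  n∣a : n ∣ a
  n∣a = coprime-divisor (Coprime.sym m⊥n) (subst (n ∣_) (trans o≡a*m (*-comm a m)) n∣o)

∣+m-+n⇒∣n∸m : ∀ {d m n} → m ≤ n → + d ∣ᵢ + m - + n → d ∣ n ∸ m
∣+m-+n⇒∣n∸m {d} {m} {n} m≤n d∣m-n =
  subst (d ∣_) (trans (cong ∣_∣ ([+m]-[+n]≡m⊖n m n)) (∣⊖∣-≤ m≤n)) (∣⇒∣ᵤ d∣m-n)

residue-of-quotient : ∀ {h k k̄ q N P} .{{_ : NonZero q}} →
  P * k ≡ h + N * q → (k * k̄) % q ≡ 1 % q → P < q → (h * k̄) % q ≡ P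
residue-of-quotient {h} {k} {k̄} {q} {N} {P} Pk≡h+Nq kk̄≡1 P<q = begin
  (h * k̄) % q                    ≡⟨ [m+kn]%n≡m%n (h * k̄) (N * k̄) q ⟨
  (h * k̄ + N * k̄ * q) % q        ≡⟨ cong (_% q) (factor h k̄ N q) ⟩
  ((h + N * q) * k̄) % q          ≡⟨ cong (λ x → (x * k̄) % q) Pk≡h+Nq ⟨
  (P * k * k̄) % q                ≡⟨ cong (_% q) (*-assoc P k k̄) ⟩
  (P * (k * k̄)) % q              ≡⟨ %-distribˡ-* P (k * k̄) q ⟩
  ((P % q) * ((k * k̄) % q)) % q  ≡⟨ cong (λ x → ((P % q) * x) % q) kk̄≡1 ⟩
  ((P % q) * (1 % q)) % q        ≡⟨ %-distribˡ-* P 1 q ⟨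
  (P * 1) % q                    ≡⟨ cong (_% q) (*-identityʳ P) ⟩
  P % q                          ≡⟨ m<n⇒m%n≡m P<q ⟩
  P                              ∎
  where
  open ≡-Reasoning
  factor : ∀ h k̄ N q → h * k̄ + N * k̄ * q ≡ (h + N * q) * k̄
  factor = solve-∀

record Expansion (h q k : ℕ) (as : List ℕ) : Set where
  field
    den≡        : den as ≡ k
    num<        : num as < k
    determinant : num⁻ as * k ≡ 1 + num as * den⁻ as
    den⁻≤       : den⁻ as ≤ k
    congruence  : + k ∣ᵢ + (h * den⁻ as) - + q

open Expansion

expansion : ∀ {h q k q̄ as} .{{_ : NonZero k}} → Coprime h k → (q * q̄) % k ≡ 1 % k →
  All (0 <_) as → 2 ∣ length as → IsCF ((- (+ (h * q̄))) %ℕ k) k as → Expansion h q k as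
expansion {h} {q} {k} {q̄} {as} h⊥k qq̄≡1 positive even isCF = record
  { den≡        = den≡k
  ; num<        = subst (_< k) (sym num≡N) (n%ℕd<d (- (+ (h * q̄))) k)
  ; determinant = determinant′
  ; den⁻≤       = subst (den⁻ as ≤_) den≡k (den⁻≤den positive)
  ; congruence  = inverse-congruence {h} {q} {num as} {k} {num⁻ as} k∣q*num+h determinant′
  }
  where
  k∣qN+h : + k ∣ᵢ + q ℤ.* + ((- (+ (h * q̄))) %ℕ k) ℤ.+ + h
  k∣qN+h = neg-inverse-congruence {h} {q} {q̄} k
    (subst (λ x → + k ∣ᵢ x - 1ℤ) (pos-* q q̄) (%-congruent k qq̄≡1))
  reduced = reduced-expansion {as = as} (congruence⇒coprime {q = q} h⊥k k∣qN+h) even isCF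
  num≡N = proj₁ reduced
  den≡k = proj₂ reduced
  k∣q*num+h : + k ∣ᵢ + q ℤ.* + num as ℤ.+ + h
  k∣q*num+h = subst (λ n → + k ∣ᵢ + q ℤ.* + n ℤ.+ + h) (sym num≡N) k∣qN+h
  determinant′ : num⁻ as * k ≡ 1 + num as * den⁻ as
  determinant′ = subst (λ n → num⁻ as * n ≡ 1 + num as * den⁻ as) den≡k
    (trans (det-even as even) (cong (λ x → 1 + x) (*-comm (den⁻ as) (num as))))

crt-excess : ∀ {h k X q} → Coprime h k → X ≤ q →
  + h ∣ᵢ + X - + q → + k ∣ᵢ + X - + q → ∃[ d ] q ≡ X + d * (h * k)
crt-excess {X = X} h⊥k X≤q h∣X-q k∣X-q
  with coprime⇒*∣ h⊥k (∣+m-+n⇒∣n∸m X≤q h∣X-q) (∣+m-+n⇒∣n∸m X≤q k∣X-q)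
... | divides d q∸X≡dhk = d , trans (sym (m+[n∸m]≡n X≤q)) (cong (λ r → X + r) q∸X≡dhk)

*≡+*⇒< : ∀ {P k h N q} → P * k ≡ h + N * q → h < q → N < k → P < q
*≡+*⇒< {P} {k} {h} {N} {q} Pk≡h+Nq h<q N<k = *-cancelʳ-< k P q (begin-strict
  P * k      ≡⟨ Pk≡h+Nq ⟩
  h + N * q  <⟨ +-monoˡ-< (N * q) h<q ⟩
  q + N * q  ≤⟨ *-monoˡ-≤ q N<k ⟩
  k * q      ≡⟨ *-comm k q ⟩
  q * k      ∎)
  where open ≤-Reasoning

glued-expansion : ∀ {h k q k̄ d bs cs} .{{_ : NonZero q}} → Expansion h q k bs → Expansion k q h cs →
  q ≡ h * den⁻ bs + k * den⁻ cs + d * (h * k) → (k * k̄) % q ≡ 1 % q → h < q →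
  IsCF ((h * k̄) % q) q (bs ++ d ∷ reverse cs)
glued-expansion {h} {k} {q} {k̄} {d} {bs} {cs} B C q≡ kk̄≡1 h<q =
  subst (λ v → proj₁ v * q ≡ proj₂ v * ((h * k̄) % q)) (sym cf-glued)
    (trans (*-comm P q) (cong₂ _*_ (sym D≡q) (sym residue)))
  where
  N = num bs
  γ = den⁻ bs
  γ′ = den⁻ cs
  P = h * num⁻ bs + (d * h + γ′) * N
  D = h * γ + (d * h + γ′) * k
  cf-glued : cf (bs ++ d ∷ reverse cs) ≡ (P , D)
  cf-glued = begin
    cf (bs ++ d ∷ reverse cs)          ≡⟨ cf-++ bs (d ∷ reverse cs) ⟩
    cfWith bs (cf (d ∷ reverse cs))    ≡⟨ cong (λ v → cfWith bs (proj₂ v , d * proj₂ v + proj₁ v)) (proj₂ (cf-reverse cs)) ⟩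
    cfWith bs (den cs , d * den cs + γ′) ≡⟨ cong (λ x → cfWith bs (x , d * x + γ′)) (den≡ C) ⟩
    cfWith bs (h , d * h + γ′)          ≡⟨ cfWith-linear bs h (d * h + γ′) ⟩
    (P , h * γ + (d * h + γ′) * den bs) ≡⟨ cong (λ x → P , h * γ + (d * h + γ′) * x) (den≡ B) ⟩
    (P , D)                            ∎
    where open ≡-Reasoning
  D≡q : D ≡ q
  D≡q = trans (regroup h γ d γ′ k) (sym q≡)
    where
    regroup : ∀ h γ d γ′ k → h * γ + (d * h + γ′) * k ≡ h * γ + k * γ′ + d * (h * k)
    regroup = solve-∀
  Pk≡h+Nq : P * k ≡ h + N * q
  Pk≡h+Nq = begin
    P * k                                  ≡⟨ expand h (num⁻ bs) (d * h + γ′) N k ⟩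
    h * (num⁻ bs * k) + N * ((d * h + γ′) * k) ≡⟨ cong (λ x → h * x + N * ((d * h + γ′) * k)) (determinant B) ⟩
    h * (1 + N * γ) + N * ((d * h + γ′) * k)   ≡⟨ collect h N γ ((d * h + γ′) * k) ⟩
    h + N * D                              ≡⟨ cong (λ x → h + N * x) D≡q ⟩
    h + N * q                              ∎
    where
    open ≡-Reasoning
    expand : ∀ h α e N k → (h * α + e * N) * k ≡ h * (α * k) + N * (e * k)
    expand = solve-∀
    collect : ∀ h N γ f → h * (1 + N * γ) + N * f ≡ h + N * (h * γ + f)
    collect = solve-∀
  residue : (h * k̄) % q ≡ P
  residue = residue-of-quotient {h} {N = N} Pk≡h+Nq kk̄≡1 (*≡+*⇒< Pk≡h+Nq h<q (num< B))

4mn≤q⇒2mn<q : ∀ {m n q} .{{_ : NonZero m}} .{{_ : NonZero n}} → 4 * m * n ≤ q → 2 * (m * n) < q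
4mn≤q⇒2mn<q {m} {n} {q} 4mn≤q = <-≤-trans (m<m+n (2 * (m * n)) 0<2mn) (subst (_≤ q) (split m n) 4mn≤q)
  where
  0<2mn : 0 < 2 * (m * n)
  0<2mn = ≤-trans (≤-trans (>-nonZero⁻¹ m) (m≤m*n m n)) (m≤n*m (m * n) 2)
  split : ∀ m n → 4 * m * n ≡ 2 * (m * n) + 2 * (m * n)
  split = solve-∀

∃-glued-expansion : ∀ {h k q k̄ bs cs} .{{_ : NonZero h}} .{{_ : NonZero k}} .{{_ : NonZero q}} →
  Coprime h k → (k * k̄) % q ≡ 1 % q → 4 * h * k ≤ q → Expansion h q k bs → Expansion k q h cs →
  ∃[ d ] (0 < d × IsCF ((h * k̄) % q) q (bs ++ d ∷ reverse cs) × ∣ + (d * (h * k)) - + q ∣ ≤ 2 * (h * k))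
∃-glued-expansion {h} {k} {q} {k̄} {bs} {cs} h⊥k kk̄≡1 4hk≤q B C =
  d , d>0 , glued-expansion B C q≡X+dhk kk̄≡1 h<q , bound
  where
  X = h * den⁻ bs + k * den⁻ cs
  X≤2hk : X ≤ 2 * (h * k)
  X≤2hk = subst (X ≤_) (double h k) (+-mono-≤ (*-monoʳ-≤ h (den⁻≤ B)) (*-monoʳ-≤ k (den⁻≤ C)))
    where
    double : ∀ h k → h * k + k * h ≡ 2 * (h * k)
    double = solve-∀
  2hk<q : 2 * (h * k) < q
  2hk<q = 4mn≤q⇒2mn<q 4hk≤q
  h<q : h < q
  h<q = ≤-<-trans (≤-trans (m≤m*n h k) (m≤n*m (h * k) 2)) 2hk<q
  X≤q : X ≤ q
  X≤q = <⇒≤ (≤-<-trans X≤2hk 2hk<q)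
  excess : ∃[ d ] q ≡ X + d * (h * k)
  excess = crt-excess h⊥k X≤q
    (subst (λ x → + h ∣ᵢ + x - + q) (+-comm (k * den⁻ cs) (h * den⁻ bs))
      (∣[a+k*b]-c {c = q} h (den⁻ bs) (congruence C)))
    (∣[a+k*b]-c {c = q} k (den⁻ cs) (congruence B))
  d = proj₁ excess
  q≡X+dhk = proj₂ excess
  d>0 : 0 < d
  d>0 = n≢0⇒n>0 λ d≡0 → <⇒≱ 2hk<q (begin
    q                 ≡⟨ q≡X+dhk ⟩
    X + d * (h * k)   ≡⟨ cong (λ e → X + e * (h * k)) d≡0 ⟩
    X + 0             ≡⟨ +-identityʳ X ⟩
    X                 ≤⟨ X≤2hk ⟩
    2 * (h * k)       ∎)
    where open ≤-Reasoning
  bound : ∣ + (d * (h * k)) - + q ∣ ≤ 2 * (h * k)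
  bound = subst (_≤ 2 * (h * k)) (sym (begin
    ∣ + (d * (h * k)) - + q ∣                  ≡⟨ cong (λ x → ∣ + (d * (h * k)) - + x ∣) q≡X+dhk ⟩
    ∣ + (d * (h * k)) - + (X + d * (h * k)) ∣  ≡⟨ ∣+n-+[m+n]∣≡m X (d * (h * k)) ⟩
    X                                          ∎)) X≤2hk
    where open ≡-Reasoning

lemma6 : ∃[ C ] ((h k q : ℕ) → .{{_ : NonZero h}} → .{{_ : NonZero k}} → .{{_ : NonZero q}}
             → Coprime h k → Coprime k q → Coprime h q
             → (qk qh kq : ℕ)
             → (q * qk) % k ≡ 1 % k → (q * qh) % h ≡ 1 % h → (k * kq) % q ≡ 1 % q
             → (bs cs : List ℕ) → All (0 <_) bs → All (0 <_) cs
             → 2 ∣ length bs → 2 ∣ length cs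
             → IsCF ((- (+ (h * qk))) %ℕ k) k bs
             → IsCF ((- (+ (k * qh))) %ℕ h) h cs
             → 4 * h * k ≤ q
             → ∃[ d ] (0 < d
                       × IsCF ((h * kq) % q) q (bs ++ d ∷ reverse cs)
                       × ∣ + (d * (h * k)) - + q ∣ ≤ C * (h * k)))
lemma6 = 2 , λ h k q h⊥k _ _ q̄ₖ q̄ₕ k̄ qq̄ₖ≡1 qq̄ₕ≡1 kk̄≡1 bs cs bs>0 cs>0 2∣bs 2∣cs bs-cf cs-cf 4hk≤q →
  ∃-glued-expansion h⊥k kk̄≡1 4hk≤q
    (expansion h⊥k qq̄ₖ≡1 bs>0 2∣bs bs-cf)
    (expansion (Coprime.sym h⊥k) qq̄ₕ≡1 cs>0 2∣cs cs-cf)
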